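{- The following are equivalent: (1) every set is discrete (has decidable equality); (2) in the 1-category of set-truncated containers and cartesian morphisms, the lax chain-rule morphism $\mathrm{chain}_{F,G}:(\partial F)[G]\times\partial G\multimap\partial(F[G])$ is an isomorphism for all set-truncated containers $F$ and $G$.
   Context: Work in Homotopy Type Theory with a univalent universe. A point $a:A$ is isolated if $a=b$ is decidable for all $b:A$; $A^{\circ}$ is the subtype of isolated points and $A\setminus a:=\sum_{b:A}\neg(a=b)$. A container $(S\triangleleft P)$ has shapes $S$ and positions $P:S\to\mathsf{Type}$; it is set-truncated if $S$ and all $P_s$ are sets. A cartesian morphism $(S\triangleleft P)\multimap(T\triangleleft Q)$ is $(f,u)$ with $f:S\to T$, $u:\prod_s Q_{fs}\simeq P_s$. Product: $(S\triangleleft P)\times(T\triangleleft Q):=(S\times T\triangleleft\lambda(s,t).P_s+Q_t)$; substitution: $(S\triangleleft P)[(T\triangleleft Q)]:=((s,f):\sum_{s}(P_s\to T)\triangleleft\sum_{p:P_s}Q_{fp})$; derivative: $\partial(S\triangleleft P):=((s,p):\sum_s (P_s)^{\circ}\triangleleft P_s\setminus p)$. Grafting: for isolated $p_0:P_s$, $f:P_s\setminus p_0\to T$, $t:T$, $\mathrm{graft}(f,t):P_s\to T$ sends $p$ to $f(p,h)$ when $h:\neg(p_0=p)$ and to $t$ when $p_0=p$. For $F=(S\triangleleft P)$, $G=(T\triangleleft Q)$, $\mathrm{chain}_{F,G}$ has shape map $(((s,p_0),f),(t,q_0))\mapsto((s,\mathrm{graft}(f,t)),(p_0,q_0))$ (with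 $q_0$ transported along $\mathrm{graft}(f,t)(p_0)=t$; the pair is isolated in $\sum_{p:P_s}Q_{\mathrm{graft}(f,t)(p)}$), and position maps given by certain equivalences $(\sum_{p:P_s}Q_{\mathrm{graft}(f,t)(p)})\setminus(p_0,q_0)\simeq(\sum_{p:P_s\setminus p_0}Q_{fp})+(Q_t\setminus q_0)$. -}

{-# OPTIONS --without-K #-}
module Defs where

open import Level using (0ℓ)
open import Data.Empty using (⊥; ⊥-elim)
open import Data.Unit using (⊤)
open import Data.Product using (Σ; _×_; _,_; proj₁; proj₂)
open import Data.Sum using (_⊎_; inj₁; inj₂)
open import Relation.Nullary using (¬_; Dec; yes; no)
open import Relation.Binary.PropositionalEquality
  using (_≡_; refl; sym; trans; cong; subst)
open import Function.Bundles using (_↔_; Inverse; mk↔ₛ′)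
open import Function.Construct.Composition using (_↔-∘_)
open import Function.Construct.Identity using (↔-id)
open import Axiom.Extensionality.Propositional using (Extensionality)

isProp : Set → Set
isProp A = (x y : A) → x ≡ y

isSet : Set → Set
isSet A = (x y : A) → isProp (x ≡ y)

Discrete : Set → Set
Discrete A = (x y : A) → Dec (x ≡ y)

isIsolated : {A : Set} → A → Set
isIsolated {A} a = (b : A) → Dec (a ≡ b)

_° : Set → Set
A ° = Σ A isIsolated

_∖_ : (A : Set) → A → Set
A ∖ a = Σ A (λ b → ¬ (a ≡ b))

record Container : Set₁ where
  constructor _◁_
  field
    Sh  : Set
    Pos : Sh → Set
open Container public

isSetTruncated : Container → Set
isSetTruncated F = isSet (Sh F) × ((s : Sh F) → isSet (Pos F s))

record _⊸_ (F G : Container) : Set where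
  constructor cart
  field
    shape : Sh F → Sh G
    pos   : (s : Sh F) → Pos G (shape s) ↔ Pos F s
open _⊸_ public

idₘ : (F : Container) → F ⊸ F
idₘ F = cart (λ s → s) (λ s → ↔-id _)

_∘ₘ_ : {F G H : Container} → G ⊸ H → F ⊸ G → F ⊸ H
(cart g v) ∘ₘ (cart f u) = cart (λ s → g (f s)) (λ s → u s ↔-∘ v (f s))

-- Equality of cartesian morphisms, written out: equal shape maps, and
-- position maps that agree after transport along that equality.
-- (Under function extensionality this is equivalent to the identity type
-- of pairs (f , u) with u a family of equivalences.)
_≈ₘ_ : {F G : Container} → F ⊸ G → F ⊸ G → Set
_≈ₘ_ {F} {G} m m' =
  Σ ((s : Sh F) → shape m s ≡ shape m' s) λ H →
    (s : Sh F) (q : Pos G (shape m s)) →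
      Inverse.to (pos m s) q ≡ Inverse.to (pos m' s) (subst (Pos G) (H s) q)

isIso : {F G : Container} → F ⊸ G → Set
isIso {F} {G} m = Σ (G ⊸ F) λ m' → ((m' ∘ₘ m) ≈ₘ idₘ F) × ((m ∘ₘ m') ≈ₘ idₘ G)

_⊗_ : Container → Container → Container
(S ◁ P) ⊗ (T ◁ Q) = (S × T) ◁ (λ st → P (proj₁ st) ⊎ Q (proj₂ st))

_[_] : Container → Container → Container
(S ◁ P) [ (T ◁ Q) ] =
  (Σ S (λ s → P s → T)) ◁ (λ sf → Σ (P (proj₁ sf)) (λ p → Q (proj₂ sf p)))

∂ : Container → Container
∂ (S ◁ P) = (Σ S (λ s → (P s) °)) ◁ (λ sp → P (proj₁ sp) ∖ proj₁ (proj₂ sp))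

module _ {A T : Set} {a₀ : A} (i₀ : isIsolated a₀)
         (f : A ∖ a₀ → T) (t : T) where

  graftD : (a : A) → Dec (a₀ ≡ a) → T
  graftD a (yes _) = t
  graftD a (no n)  = f (a , n)

  graft : A → T
  graft a = graftD a (i₀ a)

  graft-β : graft a₀ ≡ t
  graft-β with i₀ a₀
  ... | yes _ = refl
  ... | no n  = ⊥-elim (n refl)

module _ (fe : Extensionality 0ℓ 0ℓ) where

  ¬-isProp : {X : Set} → isProp (¬ X)
  ¬-isProp n n' = fe (λ x → ⊥-elim (n x))

  -- props are sets (Hedberg-style, without K)
  prop→set : {X : Set} → isProp X → isSet X
  prop→set {X} h x y p q = trans (lem p) (sym (lem q))
    where
      lem0 : {u v : X} (p : u ≡ v) → trans (h x u) p ≡ h x v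
      lem0 {u} refl = trans-refl (h x u)
        where
          trans-refl : {a b : X} (r : a ≡ b) → trans r refl ≡ r
          trans-refl refl = refl
      canc : {a b : X} (r : x ≡ a) (s : a ≡ b) → trans (sym r) (trans r s) ≡ s
      canc refl s = refl
      lem : (p : x ≡ y) → p ≡ trans (sym (h x x)) (h x y)
      lem p = trans (sym (canc (h x x) p)) (cong (trans (sym (h x x))) (lem0 p))

  ↔-remove : {X Y : Set} (e : X ↔ Y) (x₀ : X) (y₀ : Y) →
             Inverse.to e x₀ ≡ y₀ → (X ∖ x₀) ↔ (Y ∖ y₀)
  ↔-remove {X} {Y} e x₀ y₀ h = mk↔ₛ′ to' from' l r
    where
      open Inverse e
      ft : ∀ y → to (from y) ≡ y
      ft = Inverse.strictlyInverseˡ e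
      tf : ∀ x → from (to x) ≡ x
      tf = Inverse.strictlyInverseʳ e
      to' : X ∖ x₀ → Y ∖ y₀
      to' (x , n) = to x , λ q → n (trans (sym (tf x₀))
                                     (trans (cong from (trans h q)) (tf x)))
      from' : Y ∖ y₀ → X ∖ x₀
      from' (y , n) = from y , λ q → n (trans (sym h) (trans (cong to q) (ft y)))
      pair≡ : {Z : Set} {z₀ z z' : Z} {n : ¬ (z₀ ≡ z)} {n' : ¬ (z₀ ≡ z')} →
              (q : z ≡ z') → _≡_ {A = Z ∖ z₀} (z , n) (z' , n')
      pair≡ {n = n} {n'} refl = cong (_ ,_) (¬-isProp n n')
      l : ∀ y → to' (from' y) ≡ y
      l (y , n) = pair≡ (ft y)
      r : ∀ x → from' (to' x) ≡ x
      r (x , n) = pair≡ (tf x)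

  ⊎∖inj₂ : {A B : Set} (b : B) → ((A ⊎ B) ∖ inj₂ b) ↔ (A ⊎ (B ∖ b))
  ⊎∖inj₂ {A} {B} b = mk↔ₛ′ to' from' l r
    where
      to' : (A ⊎ B) ∖ inj₂ b → A ⊎ (B ∖ b)
      to' (inj₁ a , n)  = inj₁ a
      to' (inj₂ b' , n) = inj₂ (b' , λ q → n (cong inj₂ q))
      inj₂-inj : {u v : B} → _≡_ {A = A ⊎ B} (inj₂ u) (inj₂ v) → u ≡ v
      inj₂-inj refl = refl
      from' : A ⊎ (B ∖ b) → (A ⊎ B) ∖ inj₂ b
      from' (inj₁ a)        = inj₁ a , λ ()
      from' (inj₂ (b' , n)) = inj₂ b' , λ q → n (inj₂-inj q)
      l : ∀ y → to' (from' y) ≡ y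
      l (inj₁ a)        = refl
      l (inj₂ (b' , n)) = cong (λ m → inj₂ (b' , m)) (¬-isProp _ _)
      r : ∀ x → from' (to' x) ≡ x
      r (inj₁ a , n)  = cong (inj₁ a ,_) (¬-isProp _ _)
      r (inj₂ b' , n) = cong (inj₂ b' ,_) (¬-isProp _ _)

  module Split {A T : Set} (Q : T → Set) {a₀ : A} (i₀ : isIsolated a₀)
               (f : A ∖ a₀ → T) (t : T) where

    g : A → T
    g = graft i₀ f t

    X₀ : Set
    X₀ = Σ A (λ a → Q (g a))

    Y₀ : Set
    Y₀ = Σ (A ∖ a₀) (λ an → Q (f an)) ⊎ Q t

    φD : (a : A) (d : Dec (a₀ ≡ a)) → Q (graftD i₀ f t a d) → Y₀
    φD a (yes _) q = inj₂ q
    φD a (no n)  q = inj₁ ((a , n) , q)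

    φ : X₀ → Y₀
    φ (a , q) = φD a (i₀ a) q

    gηD : (a : A) (n : ¬ (a₀ ≡ a)) (d : Dec (a₀ ≡ a)) → graftD i₀ f t a d ≡ f (a , n)
    gηD a n (yes e) = ⊥-elim (n e)
    gηD a n (no n') = cong (λ m → f (a , m)) (¬-isProp n' n)

    gβD : (d : Dec (a₀ ≡ a₀)) → graftD i₀ f t a₀ d ≡ t
    gβD (yes _) = refl
    gβD (no n)  = ⊥-elim (n refl)

    ψ : Y₀ → X₀
    ψ (inj₁ ((a , n) , q)) = a , subst Q (sym (gηD a n (i₀ a))) q
    ψ (inj₂ q)             = a₀ , subst Q (sym (gβD (i₀ a₀))) q

    private
      φψ₁ : (a : A) (n : ¬ (a₀ ≡ a)) (d : Dec (a₀ ≡ a)) (q : Q (f (a , n))) →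
            φD a d (subst Q (sym (gηD a n d)) q) ≡ inj₁ ((a , n) , q)
      φψ₁ a n (yes e) q = ⊥-elim (n e)
      φψ₁ a n (no n') q = L (¬-isProp n' n) q
        where
          L : {m m' : ¬ (a₀ ≡ a)} (e : m ≡ m') (q : Q (f (a , m'))) →
              _≡_ {A = Y₀} (inj₁ ((a , m) , subst Q (sym (cong (λ k → f (a , k)) e)) q))
                           (inj₁ ((a , m') , q))
          L refl q = refl

      φψ₂ : (d : Dec (a₀ ≡ a₀)) (q : Q t) → φD a₀ d (subst Q (sym (gβD d)) q) ≡ inj₂ q
      φψ₂ (yes _) q = refl
      φψ₂ (no n)  q = ⊥-elim (n refl)

    φψ : ∀ y → φ (ψ y) ≡ y
    φψ (inj₁ ((a , n) , q)) = φψ₁ a n (i₀ a) q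
    φψ (inj₂ q)             = φψ₂ (i₀ a₀) q

    private
      βlem : (c : Dec (a₀ ≡ a₀)) (eq : c ≡ yes refl) (q : Q (graftD i₀ f t a₀ c)) →
             subst Q (sym (gβD c)) (subst (λ d → Q (graftD i₀ f t a₀ d)) eq q) ≡ q
      βlem c refl q = refl

      loop : {a : A} {n : ¬ (a₀ ≡ a)} (e : n ≡ n) → e ≡ refl → (q : Q (f (a , n))) →
             subst Q (sym (cong (λ m → f (a , m)) e)) q ≡ q
      loop e refl q = refl

      ηlem : (a : A) (n : ¬ (a₀ ≡ a)) (c : Dec (a₀ ≡ a)) (eq : c ≡ no n)
             (q : Q (graftD i₀ f t a c)) →
             subst Q (sym (gηD a n c)) (subst (λ d → Q (graftD i₀ f t a d)) eq q) ≡ q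
      ηlem a n c refl q = loop (¬-isProp n n) (prop→set ¬-isProp n n _ _) q

      ψφD : (a : A) (d : Dec (a₀ ≡ a)) (eq : i₀ a ≡ d) (q : Q (g a)) →
            ψ (φD a d (subst (λ d → Q (graftD i₀ f t a d)) eq q)) ≡ (a , q)
      ψφD a (no n) eq q = cong (a ,_) (ηlem a n (i₀ a) eq q)
      ψφD a (yes refl) eq q = cong (a₀ ,_) (βlem (i₀ a₀) eq q)

    ψφ : ∀ x → ψ (φ x) ≡ x
    ψφ (a , q) = ψφD a (i₀ a) refl q

    split : X₀ ↔ Y₀
    split = mk↔ₛ′ φ ψ φψ ψφ

    module Point (q₀ : Q t) (j₀ : isIsolated q₀) where

      x₀ : X₀
      x₀ = ψ (inj₂ q₀)

      y₀-isolated : isIsolated {Y₀} (inj₂ q₀)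
      y₀-isolated (inj₁ _) = no (λ ())
      y₀-isolated (inj₂ q) with j₀ q
      ... | yes refl = yes refl
      ... | no n = no (λ { refl → n refl })

      x₀-isolated : isIsolated x₀
      x₀-isolated x with y₀-isolated (φ x)
      ... | yes e = yes (trans (cong ψ e) (ψφ x))
      ... | no n  = no (λ e → n (trans (sym (φψ (inj₂ q₀))) (cong φ e)))

      posEquiv : (X₀ ∖ x₀) ↔ (Σ (A ∖ a₀) (λ an → Q (f an)) ⊎ (Q t ∖ q₀))
      posEquiv = ⊎∖inj₂ q₀ ↔-∘ ↔-remove split x₀ (inj₂ q₀) (φψ (inj₂ q₀))

  chain : (F G : Container) → (((∂ F) [ G ]) ⊗ (∂ G)) ⊸ (∂ (F [ G ]))
  chain (S ◁ P) (T ◁ Q) = cart sh ps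
    where
      sh : Sh (((∂ (S ◁ P)) [ T ◁ Q ]) ⊗ (∂ (T ◁ Q))) → Sh (∂ ((S ◁ P) [ T ◁ Q ]))
      sh (((s , p₀ , i₀) , f) , (t , q₀ , j₀)) =
        (s , graft i₀ f t) , Split.Point.x₀ Q i₀ f t q₀ j₀
                           , Split.Point.x₀-isolated Q i₀ f t q₀ j₀
      ps : (x : Sh (((∂ (S ◁ P)) [ T ◁ Q ]) ⊗ (∂ (T ◁ Q)))) →
           Pos (∂ ((S ◁ P) [ T ◁ Q ])) (sh x) ↔ Pos (((∂ (S ◁ P)) [ T ◁ Q ]) ⊗ (∂ (T ◁ Q))) x
      ps (((s , p₀ , i₀) , f) , (t , q₀ , j₀)) = Split.Point.posEquiv Q i₀ f t q₀ j₀

-- A cartesian morphism is invertible as soon as its shape map is, so for the first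
-- direction it suffices to invert the shape map of chain. When all sets are discrete,
-- every position p of F is isolated, so a shape ((s , h) , (p , q)) of ∂(F[G]) comes from
-- (((s , p) , h restricted to P s ∖ p) , (h p , q)), and grafting the restriction of h
-- at p with h p gives back h. Conversely, the first coordinate of the point of any shape
-- in the image of chain is isolated in P s. For F = (⊤ ◁ λ _ → A) and G = (A ◁ (x ≡_)),
-- the point (x , refl) of the contractible type Σ A (x ≡_) is always isolated, so if chain
-- is invertible then x is isolated in A.
module Submission where

open import Level using (0ℓ)
open import Axiom.Extensionality.Propositional using (Extensionality)
open import Axiom.UniquenessOfIdentityProofs using (module Decidable⇒UIP)
open import Data.Empty using (⊥-elim)
open import Data.Product using (Σ; _,_; proj₁; proj₂)
open import Data.Product.Properties using (≡-dec)
open import Data.Unit using (⊤; tt)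
open import Function.Base using (_∘_; id)
open import Function.Bundles using (_⇔_; mk⇔; Inverse; _↔_; mk↔ₛ′)
open import Function.Properties.Inverse.HalfAdjointEquivalence using (↔⇒≃; _≃_)
open import Relation.Nullary using (¬_; Dec; yes; no)
open import Relation.Binary.PropositionalEquality hiding ([_])
open import Defs

Discrete⇒isSet : {A : Set} → Discrete A → isSet A
Discrete⇒isSet _≟_ x y = Decidable⇒UIP.≡-irrelevant _≟_

shape-inverse⇒isIso : {F G : Container} (m : F ⊸ G) (g : Sh G → Sh F) →
                      (∀ y → shape m (g y) ≡ y) → (∀ x → g (shape m x) ≡ x) → isIso m
shape-inverse⇒isIso {F} {G} m g ε η = cart g pos⁻¹ , (η , inverseˡ) , (ε′ , inverseʳ)
  where
    open Inverse using (to; from; strictlyInverseˡ; strictlyInverseʳ)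

    -- ε is replaced by the counit of a half-adjoint equivalence, which is coherent with η.
    shape≃ : Sh F ≃ Sh G
    shape≃ = ↔⇒≃ (mk↔ₛ′ (shape m) g ε η)

    ε′ : ∀ y → shape m (g y) ≡ y
    ε′ = _≃_.right-inverse-of shape≃

    pos⁻¹ : (y : Sh G) → Pos F (g y) ↔ Pos G y
    pos⁻¹ y = mk↔ₛ′ (subst (Pos G) (ε′ y) ∘ from (pos m (g y)))
                    (to (pos m (g y)) ∘ subst (Pos G) (sym (ε′ y)))
                    (λ q → trans (cong (subst (Pos G) (ε′ y)) (strictlyInverseʳ (pos m (g y)) _))
                                 (subst-subst-sym (ε′ y)))
                    (λ p → trans (cong (to (pos m (g y))) (subst-sym-subst (ε′ y)))
                                 (strictlyInverseˡ (pos m (g y)) p))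

    transport-pos : {x x′ : Sh F} (e : x ≡ x′) (p : Pos F x) →
                    to (pos m x′) (subst (Pos G) (cong (shape m) e) (from (pos m x) p))
                      ≡ subst (Pos F) e p
    transport-pos refl p = strictlyInverseˡ (pos m _) p

    inverseˡ : (x : Sh F) (p : Pos F (g (shape m x))) →
               to (pos m x) (subst (Pos G) (ε′ (shape m x)) (from (pos m (g (shape m x))) p))
                 ≡ subst (Pos F) (η x) p
    inverseˡ x p =
      trans (cong (λ e → to (pos m x) (subst (Pos G) e (from (pos m (g (shape m x))) p)))
                  (sym (_≃_.left-right shape≃ x)))
            (transport-pos (η x) p)

    inverseʳ : (y : Sh G) (q : Pos G (shape m (g y))) →
               subst (Pos G) (ε′ y) (from (pos m (g y)) (to (pos m (g y)) q))
                 ≡ subst (Pos G) (ε′ y) q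
    inverseʳ y q = cong (subst (Pos G) (ε′ y)) (strictlyInverseʳ (pos m (g y)) q)

singleton-centre-isolated : {A : Set} (x : A) → isIsolated {Σ A (x ≡_)} (x , refl)
singleton-centre-isolated x (_ , refl) = yes refl

module _ (fe : Extensionality 0ℓ 0ℓ) where

  Dec-isProp : {X : Set} → isProp X → isProp (Dec X)
  Dec-isProp X-prop (yes x) (yes x′) = cong yes (X-prop x x′)
  Dec-isProp X-prop (yes x) (no ¬x)  = ⊥-elim (¬x x)
  Dec-isProp X-prop (no ¬x) (yes x)  = ⊥-elim (¬x x)
  Dec-isProp X-prop (no ¬x) (no ¬x′) = cong no (¬-isProp fe ¬x ¬x′)

  isIsolated-isProp : {A : Set} → isSet A → (a : A) → isProp (isIsolated a)
  isIsolated-isProp A-set a i i′ = fe λ b → Dec-isProp (A-set a b) (i b) (i′ b)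

  Σ°-≡ : {X : Set} {B : X → Set} → (∀ x → isSet (B x)) →
         {x x′ : X} (e : x ≡ x′) {b : B x} {b′ : B x′} → subst B e b ≡ b′ →
         {i : isIsolated b} {i′ : isIsolated b′} →
         _≡_ {A = Σ X (λ x → B x °)} (x , b , i) (x′ , b′ , i′)
  Σ°-≡ B-set refl refl = cong (λ i → _ , _ , i) (isIsolated-isProp (B-set _) _ _ _)

  module _ {A T : Set} {a₀ : A} (i₀ : isIsolated a₀) where

    graft-≢ : (f : A ∖ a₀ → T) (t : T) (a : A) (n : ¬ a₀ ≡ a) → graft i₀ f t a ≡ f (a , n)
    graft-≢ f t a n with i₀ a
    ... | yes e  = ⊥-elim (n e)
    ... | no n′ = cong (λ n → f (a , n)) (¬-isProp fe n′ n)

    graft-restrict : (h : A → T) → graft i₀ (h ∘ proj₁) (h a₀) ≡ h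
    graft-restrict h = fe graft-restrict-at
      where
        graft-restrict-at : (a : A) → graft i₀ (h ∘ proj₁) (h a₀) a ≡ h a
        graft-restrict-at a with i₀ a
        ... | yes e = cong h e
        ... | no _  = refl

  module ChainInverse {S T : Set} {P : S → Set} {Q : T → Set}
                      (P-discrete : ∀ s → Discrete (P s)) (T-set : isSet T)
                      (Q-discrete : ∀ t → Discrete (Q t)) where

    F G : Container
    F = S ◁ P
    G = T ◁ Q

    unchain : Sh (∂ (F [ G ])) → Sh ((∂ F [ G ]) ⊗ ∂ G)
    unchain ((s , h) , (p , q) , _) =
      ((s , p , P-discrete s p) , h ∘ proj₁) , (h p , q , Q-discrete (h p) q)

    ∂[]-shape-≡ : {s : S} {h h′ : P s → T} (E : h ≡ h′) {p : P s} {q : Q (h p)} {q′ : Q (h′ p)} →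
                  subst Q (cong-app E p) q ≡ q′ → {k : isIsolated (p , q)} {k′ : isIsolated (p , q′)} →
                  _≡_ {A = Sh (∂ (F [ G ]))} ((s , h) , (p , q) , k) ((s , h′) , (p , q′) , k′)
    ∂[]-shape-≡ refl q≡q′ = Σ°-≡ pos-set refl (cong (_ ,_) q≡q′)
      where
        pos-set : (sh : Sh (F [ G ])) → isSet (Pos (F [ G ]) sh)
        pos-set (s , h) = Discrete⇒isSet (≡-dec (P-discrete s) (Q-discrete (h _)))

    chain-unchain : ∀ c → shape (chain fe F G) (unchain c) ≡ c
    chain-unchain ((s , h) , (p , q) , _) =
      ∂[]-shape-≡ (graft-restrict i h)
        (trans (cong (λ e → subst Q e (subst Q (sym β) q)) (T-set _ _ (cong-app (graft-restrict i h) p) β))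
               (subst-subst-sym β))
      where
        i = P-discrete s p
        β = Split.gβD fe Q i (h ∘ proj₁) (h p) (i p)

    unchain-chain : ∀ d → unchain (shape (chain fe F G) d) ≡ d
    unchain-chain (((s , p₀ , i₀) , f) , (t , q₀ , j₀)) =
      cong₂ _,_
        (cong₂ (λ i f → (s , p₀ , i) , f)
               (isIsolated-isProp (Discrete⇒isSet (P-discrete s)) p₀ _ i₀)
               (fe λ { (a , n) → graft-≢ i₀ f t a n }))
        (Σ°-≡ (Discrete⇒isSet ∘ Q-discrete) β (subst-subst-sym β))
      where
        β = Split.gβD fe Q i₀ f t (i₀ p₀)

  chain-isIso : (F G : Container) → (∀ s → Discrete (Pos F s)) → isSet (Sh G) →
                (∀ t → Discrete (Pos G t)) → isIso (chain fe F G)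
  chain-isIso (S ◁ P) (T ◁ Q) P-discrete T-set Q-discrete =
    shape-inverse⇒isIso (chain fe _ _) unchain chain-unchain unchain-chain
    where open ChainInverse P-discrete T-set Q-discrete

  chain-image-isolated : (F G : Container) (d : Sh ((∂ F [ G ]) ⊗ ∂ G))
                         {s : Sh F} {h : Pos F s → Sh G} {p : Pos F s} {q : Pos G (h p)}
                         {k : isIsolated {Σ (Pos F s) (Pos G ∘ h)} (p , q)} →
                         shape (chain fe F G) d ≡ ((s , h) , (p , q) , k) → isIsolated p
  chain-image-isolated (S ◁ P) (T ◁ Q) (((_ , _ , i₀) , _) , _) e =
    subst (λ sp → isIsolated (proj₂ sp)) (cong (λ c → proj₁ (proj₁ c) , proj₁ (proj₁ (proj₂ c))) e) i₀

  chain-isIso⇒discrete :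
    ((F G : Container) → isSetTruncated F → isSetTruncated G → isIso (chain fe F G)) →
    (A : Set) → isSet A → Discrete A
  chain-isIso⇒discrete chain-iso A A-set x =
    chain-image-isolated F G (shape chain⁻¹ c) (proj₁ (proj₂ (proj₂ iso)) c)
    where
      F G : Container
      F = ⊤ ◁ λ _ → A
      G = A ◁ (x ≡_)
      iso = chain-iso F G (prop→set fe (λ _ _ → refl) , λ _ → A-set)
                          (A-set , λ b → prop→set fe (A-set x b))
      chain⁻¹ = proj₁ iso
      c : Sh (∂ (F [ G ]))
      c = (tt , id) , (x , refl) , singleton-centre-isolated x

corollary4p7 : (fe : Extensionality 0ℓ 0ℓ) →
    ((A : Set) → isSet A → Discrete A)
      ⇔ ((F G : Container) → isSetTruncated F → isSetTruncated G → isIso (chain fe F G))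
corollary4p7 fe = mk⇔ discrete⇒chain-isIso (chain-isIso⇒discrete fe)
  where
    discrete⇒chain-isIso : ((A : Set) → isSet A → Discrete A) →
      (F G : Container) → isSetTruncated F → isSetTruncated G → isIso (chain fe F G)
    discrete⇒chain-isIso discrete F G (_ , P-set) (T-set , Q-set) =
      chain-isIso fe F G (λ s → discrete _ (P-set s)) T-set (λ t → discrete _ (Q-set t))
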